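{- Let $\Sigma$ be a finite nonempty alphabet and let $S$ be a finite set of nonempty words over $\Sigma$ such that $S^*$ is co-finite and $S^* \ne \Sigma^*$. Then for every $x \in S$ there exists $x' \in S$ such that $x$ is a proper prefix of $x'$ or $x'$ is a proper prefix of $x$. Similarly, for every $x \in S$ there exists $x' \in S$ such that $x$ is a proper suffix of $x'$ or $x'$ is a proper suffix of $x$.
   Context: $u$ is a proper prefix of $v$ if $v = uz$ for a nonempty word $z$; $u$ is a proper suffix of $v$ if $v = zu$ for a nonempty word $z$. A language $L \subseteq \Sigma^*$ is co-finite if $\Sigma^* \setminus L$ is finite. -}

module Defs where

open import Data.List using (List; []; _∷_; _++_)
open import Data.List.Membership.Propositional using (_∈_)
open import Data.Product using (Σ; ∃; _×_; _,_)
open import Relation.Binary.PropositionalEquality using (_≡_)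
open import Relation.Nullary using (¬_)
open import Data.Empty using (⊥)

Word : Set → Set
Word A = List A

NonEmptyWord : {A : Set} → Word A → Set
NonEmptyWord w = ¬ (w ≡ [])

data InStar {A : Set} (S : List (Word A)) : Word A → Set where
  ε-star : InStar S []
  cat-star : ∀ {x w} → x ∈ S → InStar S w → InStar S (x ++ w)

CoFinite : {A : Set} → (Word A → Set) → Set
CoFinite {A} L = Σ (List (Word A)) λ F → ∀ w → ¬ L w → w ∈ F

ProperPrefix : {A : Set} → Word A → Word A → Set
ProperPrefix {A} u v = Σ (Word A) λ z → NonEmptyWord z × (v ≡ u ++ z)

ProperSuffix : {A : Set} → Word A → Word A → Set
ProperSuffix {A} u v = Σ (Word A) λ z → NonEmptyWord z × (v ≡ z ++ u)

-- If x ∈ S were prefix-incomparable with every other word of S, then the first factor of any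
-- factorisation of x u over S would have to be x itself, so x u ∈ S* forces u ∈ S*.  Starting
-- from some w ∉ S*, the words xⁿ w would then all lie outside S*; their lengths are unbounded,
-- contradicting co-finiteness.  The suffix statement is the prefix statement for the reversed
-- words, since reversal maps S* onto (reverse S)*.
module Submission where

open import Defs
open import Data.Nat using (ℕ; zero; suc; _≤_; z≤n; s≤s)
open import Data.Nat.Properties using (≤-trans; m≤n+m; <-irrefl)
open import Data.Nat.GeneralisedArithmetic using (fold)
open import Data.Fin using (Fin)
open import Data.Fin.Properties using (_≟_)
open import Data.List using (List; []; _∷_; _++_; length; map; reverse)
open import Data.List.Properties
  using (∷-injective; ++-assoc; ++-conicalˡ; ++-identityʳ; length-++; reverse-++; reverse-involutive;
         reverse-injective; map-∘; map-cong; map-id)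
open import Data.List.Extrema.Nat using (max; xs≤max)
open import Data.List.Relation.Unary.All using (All)
import Data.List.Relation.Unary.All as All
open import Data.List.Relation.Unary.All.Properties using (map⁺)
open import Data.List.Relation.Unary.Any using (any?)
open import Data.List.Membership.Propositional using (_∈_; find; lose)
open import Data.List.Membership.Propositional.Properties using (∈-map⁺; ∈-map⁻)
open import Data.Product using (Σ; _×_; _,_; proj₁; proj₂)
open import Data.Sum using (_⊎_; inj₁; inj₂)
open import Data.Empty using (⊥-elim)
open import Function using (_∘_)
open import Relation.Nullary using (¬_; Dec; yes; no)
open import Relation.Nullary.Decidable using (_⊎-dec_)
open import Relation.Binary.Definitions using (DecidableEquality)
open import Relation.Binary.PropositionalEquality
  using (_≡_; refl; sym; trans; cong; subst; subst₂; module ≡-Reasoning)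

module _ {A : Set} where

  private variable
    S : List (Word A)
    u v x : Word A

  PrefixComparable : Word A → Word A → Set
  PrefixComparable x y = ProperPrefix x y ⊎ ProperPrefix y x

  SuffixComparable : Word A → Word A → Set
  SuffixComparable x y = ProperSuffix x y ⊎ ProperSuffix y x

  prefix-trichotomy : ∀ y x {w v} → y ++ w ≡ x ++ v →
                      PrefixComparable y x ⊎ (y ≡ x × w ≡ v)
  prefix-trichotomy []      []      eq = inj₂ (refl , eq)
  prefix-trichotomy []      (a ∷ x) eq = inj₁ (inj₁ (a ∷ x , (λ ()) , refl))
  prefix-trichotomy (b ∷ y) []      eq = inj₁ (inj₂ (b ∷ y , (λ ()) , refl))
  prefix-trichotomy (b ∷ y) (a ∷ x) eq with ∷-injective eq
  ... | refl , eq′ with prefix-trichotomy y x eq′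
  ... | inj₁ (inj₁ (z , nz , e)) = inj₁ (inj₁ (z , nz , cong (b ∷_) e))
  ... | inj₁ (inj₂ (z , nz , e)) = inj₁ (inj₂ (z , nz , cong (b ∷_) e))
  ... | inj₂ (y≡x , w≡v)         = inj₂ (cong (b ∷_) y≡x , w≡v)

  properPrefix? : DecidableEquality A → (x y : Word A) → Dec (ProperPrefix x y)
  properPrefix? _≟A_ []      []      = no λ { (z , nz , e) → nz (sym e) }
  properPrefix? _≟A_ []      (b ∷ y) = yes (b ∷ y , (λ ()) , refl)
  properPrefix? _≟A_ (a ∷ x) []      = no λ { (z , nz , ()) }
  properPrefix? _≟A_ (a ∷ x) (b ∷ y) with a ≟A b
  ... | no a≢b = no λ { (z , nz , e) → a≢b (sym (proj₁ (∷-injective e))) }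
  ... | yes refl with properPrefix? _≟A_ x y
  ... | yes (z , nz , e) = yes (z , nz , cong (a ∷_) e)
  ... | no ¬p            = no λ { (z , nz , e) → ¬p (z , nz , proj₂ (∷-injective e)) }

  reverse-nonEmpty : {z : Word A} → NonEmptyWord z → NonEmptyWord (reverse z)
  reverse-nonEmpty nz = nz ∘ reverse-injective

  reverse-properPrefix : ∀ x y → ProperPrefix (reverse x) (reverse y) → ProperSuffix x y
  reverse-properPrefix x y (z , nz , e) = reverse z , reverse-nonEmpty nz , (begin
    y                                ≡⟨ sym (reverse-involutive y) ⟩
    reverse (reverse y)              ≡⟨ cong reverse e ⟩
    reverse (reverse x ++ z)         ≡⟨ reverse-++ (reverse x) z ⟩
    reverse z ++ reverse (reverse x) ≡⟨ cong (reverse z ++_) (reverse-involutive x) ⟩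
    reverse z ++ x                   ∎)
    where open ≡-Reasoning

  reverse-prefixComparable : ∀ x y → PrefixComparable (reverse x) (reverse y) → SuffixComparable x y
  reverse-prefixComparable x y (inj₁ p) = inj₁ (reverse-properPrefix x y p)
  reverse-prefixComparable x y (inj₂ p) = inj₂ (reverse-properPrefix y x p)

  length-fold-++ : ∀ {x : Word A} → NonEmptyWord x → ∀ w n → n ≤ length (fold w (x ++_) n)
  length-fold-++ {[]}    nx w n       = ⊥-elim (nx refl)
  length-fold-++ {a ∷ x} nx w zero    = z≤n
  length-fold-++ {a ∷ x} nx w (suc n) rewrite length-++ x {fold w ((a ∷ x) ++_) n} =
    s≤s (≤-trans (length-fold-++ nx w n) (m≤n+m _ (length x)))

  length≤max : ∀ {w : Word A} F → w ∈ F → length w ≤ max 0 (map length F)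
  length≤max F w∈F = All.lookup (xs≤max 0 (map length F)) (∈-map⁺ length w∈F)

  unbounded-family-escapes : ∀ F (f : ℕ → Word A) → (∀ n → n ≤ length (f n)) → ¬ (∀ n → f n ∈ F)
  unbounded-family-escapes F f grows f∈F =
    <-irrefl refl (≤-trans (grows (suc m)) (length≤max F (f∈F (suc m))))
    where m = max 0 (map length F)

  star-singleton : x ∈ S → InStar S x
  star-singleton {x = x} {S = S} x∈ = subst (InStar S) (++-identityʳ x) (cat-star x∈ ε-star)

  star-++ : InStar S u → InStar S v → InStar S (u ++ v)
  star-++ ε-star rv = rv
  star-++ {S = S} {v = v} (cat-star {x} {w} x∈ rw) rv =
    subst (InStar S) (sym (++-assoc x w v)) (cat-star x∈ (star-++ rw rv))

  star-reverse : InStar S u → InStar (map reverse S) (reverse u)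
  star-reverse ε-star = ε-star
  star-reverse (cat-star {x} {w} x∈ rw) =
    subst (InStar _) (sym (reverse-++ x w))
      (star-++ (star-reverse rw) (star-singleton (∈-map⁺ reverse x∈)))

  PrefixIsolated : List (Word A) → Word A → Set
  PrefixIsolated S x = ∀ y → y ∈ S → ¬ PrefixComparable x y

  star-cancelˡ : NonEmptyWord x → PrefixIsolated S x →
                 InStar S u → u ≡ x ++ v → InStar S v
  star-cancelˡ {x = x} nx isolated ε-star e = ⊥-elim (nx (++-conicalˡ x _ (sym e)))
  star-cancelˡ {x = x} {S = S} nx isolated (cat-star {y} y∈ rw) e with prefix-trichotomy y x e
  ... | inj₁ (inj₁ p)  = ⊥-elim (isolated y y∈ (inj₂ p))
  ... | inj₁ (inj₂ p)  = ⊥-elim (isolated y y∈ (inj₁ p))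
  ... | inj₂ (_ , w≡v) = subst (InStar S) w≡v rw

  star-cancel-powerˡ : NonEmptyWord x → PrefixIsolated S x →
                       ∀ w n → InStar S (fold w (x ++_) n) → InStar S w
  star-cancel-powerˡ nx isolated w zero    r = r
  star-cancel-powerˡ nx isolated w (suc n) r =
    star-cancel-powerˡ nx isolated w n (star-cancelˡ nx isolated r refl)

  ¬prefixIsolated : NonEmptyWord x → CoFinite (InStar S) →
                    Σ (Word A) (λ w → ¬ InStar S w) → ¬ PrefixIsolated S x
  ¬prefixIsolated {x = x} nx (F , cofinite) (w , w∉) isolated =
    unbounded-family-escapes F xⁿw (length-fold-++ nx w) λ n →
      cofinite (xⁿw n) (w∉ ∘ star-cancel-powerˡ nx isolated w n)
    where
    xⁿw : ℕ → Word A
    xⁿw = fold w (x ++_)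

  map-reverse-involutive : (S : List (Word A)) → map reverse (map reverse S) ≡ S
  map-reverse-involutive S =
    trans (sym (map-∘ S)) (trans (map-cong reverse-involutive S) (map-id S))

  star-reverse⁻ : InStar (map reverse S) (reverse u) → InStar S u
  star-reverse⁻ {S = S} {u = u} r =
    subst₂ InStar (map-reverse-involutive S) (reverse-involutive u) (star-reverse r)

  cofinite-star-reverse : CoFinite (InStar S) → CoFinite (InStar (map reverse S))
  cofinite-star-reverse (F , cofinite) = map reverse F , λ v v∉ →
    subst (_∈ map reverse F) (reverse-involutive v)
      (∈-map⁺ reverse (cofinite (reverse v)
        (v∉ ∘ subst (InStar _) (reverse-involutive v) ∘ star-reverse)))

  module _ (_≟A_ : DecidableEquality A) where

    prefixComparable-member : All NonEmptyWord S → CoFinite (InStar S) →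
                              Σ (Word A) (λ w → ¬ InStar S w) →
                              ∀ x → x ∈ S → Σ (Word A) λ x′ → x′ ∈ S × PrefixComparable x x′
    prefixComparable-member {S} nonEmpty cofinite escape x x∈
      with any? (λ y → properPrefix? _≟A_ x y ⊎-dec properPrefix? _≟A_ y x) S
    ... | yes comparable = find comparable
    ... | no ¬comparable = ⊥-elim (¬prefixIsolated (All.lookup nonEmpty x∈) cofinite escape
                                     λ y y∈ → ¬comparable ∘ lose y∈)

    suffixComparable-member : All NonEmptyWord S → CoFinite (InStar S) →
                              Σ (Word A) (λ w → ¬ InStar S w) →
                              ∀ x → x ∈ S → Σ (Word A) λ x′ → x′ ∈ S × SuffixComparable x x′
    suffixComparable-member nonEmpty cofinite (w , w∉) x x∈
      with prefixComparable-member (map⁺ (All.map reverse-nonEmpty nonEmpty))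
             (cofinite-star-reverse cofinite) (reverse w , w∉ ∘ star-reverse⁻)
             (reverse x) (∈-map⁺ reverse x∈)
    ... | x′ʳ , x′ʳ∈ , comparable with ∈-map⁻ reverse x′ʳ∈
    ... | x′ , x′∈ , refl = x′ , x′∈ , reverse-prefixComparable x x′ comparable

proposition17 : (k : ℕ) → (S : List (Word (Fin (suc k))))
    → All NonEmptyWord S
    → CoFinite (InStar S)
    → Σ (Word (Fin (suc k))) (λ w → ¬ InStar S w)
    → (∀ x → x ∈ S → Σ (Word (Fin (suc k))) λ x' → x' ∈ S × (ProperPrefix x x' ⊎ ProperPrefix x' x))
    × (∀ x → x ∈ S → Σ (Word (Fin (suc k))) λ x' → x' ∈ S × (ProperSuffix x x' ⊎ ProperSuffix x' x))
proposition17 k S nonEmpty cofinite escape =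
    prefixComparable-member _≟_ nonEmpty cofinite escape
  , suffixComparable-member _≟_ nonEmpty cofinite escape
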